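{- Let $k,n\in\mathbb{N}$ with $n=16k$, and let $G=C_n(\{1,4,n-4,n-1\})$. Then $\lambda_{(3,2,1)}(G)=15$.
   Context: For $n\ge 3$ and $S\subseteq\{1,\dots,n-1\}$ closed under $x\mapsto n-x$, the circulant $C_n(S)$ is the graph with vertex set $\{u_1,\dots,u_n\}$ in which $u_iu_j$ is an edge iff $|i-j|\in S$. An $L(3,2,1)$-labeling of a graph $G$ is a function $f:V(G)\to\mathbb{N}\cup\{0\}$ such that $|f(x)-f(y)|>3-\operatorname{dist}_G(x,y)$ for all distinct $x,y\in V(G)$. $\lambda_{(3,2,1)}(G)$ is the minimum, over all $L(3,2,1)$-labelings of $G$, of the difference between the largest and smallest label used. -}

module Defs where

open import Data.Nat using (ℕ; zero; suc; _+_; _*_; _≤_; _<_; _∸_; ∣_-_∣)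
open import Data.Fin using (Fin; toℕ)
open import Data.List using (List; _∷_; [])
open import Data.List.Membership.Propositional using (_∈_)
open import Data.Product using (Σ; ∃; _×_)
open import Relation.Binary.PropositionalEquality using (_≡_; _≢_)
open import Relation.Nullary using (¬_)

-- Vertices u_1,…,u_n of C_n(S) are represented by Fin n (u_{i+1} ↦ i);
-- |i - j| is unchanged by this shift.
-- u_i u_j is an edge iff i ≠ j and |i - j| ∈ S.
CircAdj : (n : ℕ) → List ℕ → Fin n → Fin n → Set
CircAdj n S x y = (x ≢ y) × (∣ toℕ x - toℕ y ∣ ∈ S)

data Walk {V : Set} (Adj : V → V → Set) : V → V → ℕ → Set where
  nil  : ∀ {x} → Walk Adj x x zero
  cons : ∀ {x y z l} → Adj x y → Walk Adj y z l → Walk Adj x z (suc l)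

IsDist : {V : Set} → (V → V → Set) → V → V → ℕ → Set
IsDist Adj x y d = Walk Adj x y d × (∀ e → e < d → ¬ Walk Adj x y e)

-- L(3,2,1)-labeling: |f x - f y| > 3 - dist(x,y) for distinct x,y
-- (equivalently, over ℕ: |f x - f y| + dist(x,y) > 3; vacuous if unreachable).
IsL321 : {V : Set} → (V → V → Set) → (V → ℕ) → Set
IsL321 Adj f = ∀ x y → x ≢ y → ∀ d → IsDist Adj x y d → 3 < ∣ f x - f y ∣ + d

HasSpan : {V : Set} → (V → ℕ) → ℕ → Set
HasSpan {V} f s = Σ ℕ λ lo →
  (∀ x → lo ≤ f x × f x ≤ lo + s) ×
  (∃ λ x → f x ≡ lo) × (∃ λ y → f y ≡ lo + s)

Lambda321≡ : {V : Set} → (V → V → Set) → ℕ → Set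
Lambda321≡ {V} Adj m =
  (Σ (V → ℕ) λ f → IsL321 Adj f × HasSpan f m) ×
  (∀ (f : V → ℕ) s → IsL321 Adj f → HasSpan f s → m ≤ s)

{-# OPTIONS --safe #-}
module Submission where

open import Defs
open import Data.Nat using (ℕ; _*_; _∸_; _≤_)
open import Data.List using (_∷_; [])
open import Relation.Binary.PropositionalEquality using (_≡_)

open import Data.Bool using (Bool; true; _∧_; T)
open import Data.Bool.ListAction using (any)
open import Data.Bool.Properties using (T-∧)
open import Data.Fin using (Fin; toℕ)
open import Data.Fin.Properties using (toℕ-fromℕ<; toℕ-injective; toℕ<n; all?)
open import Data.List using (List; lookup; applyDownFrom; downFrom; cartesianProductWith)
open import Data.List.Membership.Propositional using (_∈_; lose)
open import Data.List.Membership.Propositional.Properties using (∈-downFrom⁺; ∈-cartesianProductWith⁺)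
open import Data.List.Relation.Unary.All as All using (All)
open import Data.List.Relation.Unary.Any using (here; there)
open import Data.List.Relation.Unary.Any.Properties using (any⁺)
open import Data.Nat using (zero; suc; _+_; _<_; _≤ᵇ_; _%_; ∣_-_∣; NonZero; >-nonZero; >-nonZero⁻¹; z≤n; s≤s; _≟_; _<?_; _≤?_)
open import Data.Nat.Properties
open import Algebra.Properties.CommutativeSemigroup +-commutativeSemigroup using (x∙yz≈xz∙y; xy∙z≈xz∙y)
open import Data.Nat.DivMod using (_mod_; %-distribˡ-+; m%n%n≡m%n; [m+n]%n≡m%n; [m+kn]%n≡m%n; m<n⇒m%n≡m; m%n<n; m≤n⇒[n∸m]%m≡n%m; m∣n⇒o%n%m≡o%m)
open import Data.Nat.Divisibility using (_∣_; m∣m*n)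
open import Data.Nat.Induction using (<-rec)
open import Data.Product using (∃-syntax; _×_; _,_; proj₁; proj₂; swap)
open import Data.Sum using (_⊎_; inj₁; inj₂; [_,_])
open import Function.Bundles using (Equivalence)
open import Relation.Binary.PropositionalEquality using (_≢_; refl; sym; trans; cong; cong₂; subst; subst₂; module ≡-Reasoning)
open import Relation.Nullary using (¬_; ¬?; yes; no)
open import Relation.Nullary.Decidable using (True; toWitness; From-yes; from-yes; _→-dec_)
open import Relation.Unary using (Decidable)

open ≡-Reasoning

-- Upper bound: label u_i by `label (i mod 16)`. A walk of length d moves the index by d steps ±1, ±4; as
-- 16 ∣ n this determines the residue mod 16 of its end from that of its start, and for d ≤ 3 the net move is
-- nonzero between distinct vertices since it is smaller than n. So the condition is a finite check over
-- residues and step sequences.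
-- Lower bound: u_i and u_{i+t} are joined by a walk of length 1, 2, 2, 1, 2, 3, 3, 2, 3 for t = 1, …, 9 and
-- of length 3 for t = 12, which forces their labels 4 minus that length apart. An exhaustive search shows
-- that no 22 consecutive labels from a window of 15 values meet all these constraints.

WalkSeparated : {V : Set} → (V → V → Set) → (V → ℕ) → Set
WalkSeparated Adj f = ∀ {x y d} → x ≢ y → Walk Adj x y d → 3 < ∣ f x - f y ∣ + d

walkSeparated⇒isL321 : ∀ {V} {Adj : V → V → Set} {f} → WalkSeparated Adj f → IsL321 Adj f
walkSeparated⇒isL321 separated x y x≢y d (w , _) = separated x≢y w

-- If the bound failed for some walk, the bound for all shorter walks would make it a shortest one.
isL321⇒walkSeparated : ∀ {V} {Adj : V → V → Set} {f} → IsL321 Adj f → WalkSeparated Adj f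
isL321⇒walkSeparated {Adj = Adj} {f} isL321 {d = d} = <-rec P separated d
  where
  P : ℕ → Set
  P d = ∀ {x y} → x ≢ y → Walk Adj x y d → 3 < ∣ f x - f y ∣ + d

  separated : ∀ d → (∀ {e} → e < d → P e) → P d
  separated d shorter {x} {y} x≢y w with 3 <? ∣ f x - f y ∣ + d
  ... | yes bound = bound
  ... | no ¬bound = isL321 x y x≢y d (w , λ e e<d w′ →
        ¬bound (≤-trans (shorter e<d x≢y w′) (+-monoʳ-≤ ∣ f x - f y ∣ (<⇒≤ e<d))))

walk-gmap : ∀ {V W : Set} {A : V → V → Set} {B : W → W → Set} (h : V → W) →
            (∀ {a b} → A a b → B (h a) (h b)) → ∀ {a b d} → Walk A a b d → Walk B (h a) (h b) d
walk-gmap h hom nil        = nil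
walk-gmap h hom (cons e w) = cons (hom e) (walk-gmap h hom w)

circAdj-sym : ∀ {n S} {x y : Fin n} → CircAdj n S x y → CircAdj n S y x
circAdj-sym {S = S} {x} {y} (x≢y , x-y∈S) = (λ y≡x → x≢y (sym y≡x)) , subst (_∈ S) (∣-∣-comm (toℕ x) (toℕ y)) x-y∈S

m+∣m-n∣≡n⊎n+∣m-n∣≡m : ∀ m n → m + ∣ m - n ∣ ≡ n ⊎ n + ∣ m - n ∣ ≡ m
m+∣m-n∣≡n⊎n+∣m-n∣≡m m n with ≤-total m n
... | inj₁ m≤n = inj₁ (trans (cong (m +_) (m≤n⇒∣m-n∣≡n∸m m≤n)) (m+[n∸m]≡n m≤n))
... | inj₂ n≤m = inj₂ (trans (cong (n +_) (m≤n⇒∣n-m∣≡n∸m n≤m)) (m+[n∸m]≡n n≤m))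

%-cong-+ʳ : ∀ a b c n .{{_ : NonZero n}} → a % n ≡ b % n → (a + c) % n ≡ (b + c) % n
%-cong-+ʳ a b c n eq = begin
  (a + c) % n          ≡⟨ %-distribˡ-+ a c n ⟩
  (a % n + c % n) % n  ≡⟨ cong (λ r → (r + c % n) % n) eq ⟩
  (b % n + c % n) % n  ≡⟨ %-distribˡ-+ b c n ⟨
  (b + c) % n          ∎

%-cancel-+ʳ : ∀ a b c n .{{_ : NonZero n}} → (a + c) % n ≡ (b + c) % n → a % n ≡ b % n
%-cancel-+ʳ a b c n eq = begin
  a % n                      ≡⟨ [m+kn]%n≡m%n a c n ⟨
  (a + c * n) % n            ≡⟨ cong (_% n) (split a) ⟩
  (a + c + (c * n ∸ c)) % n  ≡⟨ %-cong-+ʳ (a + c) (b + c) (c * n ∸ c) n eq ⟩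
  (b + c + (c * n ∸ c)) % n  ≡⟨ cong (_% n) (split b) ⟨
  (b + c * n) % n            ≡⟨ [m+kn]%n≡m%n b c n ⟩
  b % n                      ∎
  where
  split : ∀ x → x + c * n ≡ x + c + (c * n ∸ c)
  split x = trans (cong (x +_) (sym (m+[n∸m]≡n (m≤m*n c n)))) (sym (+-assoc x c _))

[k+m]%n≡[m%n+k]%n : ∀ m k n .{{_ : NonZero n}} → (k + m) % n ≡ (m % n + k) % n
[k+m]%n≡[m%n+k]%n m k n = trans (cong (_% n) (+-comm k m)) (%-cong-+ʳ m (m % n) k n (sym (m%n%n≡m%n m n)))

∣m%n-[k+m]%n∣≡k⊎n∸k : ∀ m k n .{{_ : NonZero n}} → k < n → ∣ m % n - (k + m) % n ∣ ≡ k ⊎ ∣ m % n - (k + m) % n ∣ ≡ n ∸ k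
∣m%n-[k+m]%n∣≡k⊎n∸k m k n k<n with m % n + k <? n
... | yes no-wrap = inj₁ (begin
  ∣ m % n - (k + m) % n ∣  ≡⟨ cong (∣ m % n -_∣) (trans ([k+m]%n≡[m%n+k]%n m k n) (m<n⇒m%n≡m no-wrap)) ⟩
  ∣ m % n - m % n + k ∣    ≡⟨ ∣m-m+n∣≡n (m % n) k ⟩
  k                        ∎)
... | no wrap = inj₂ (begin
  ∣ m % n - (k + m) % n ∣                  ≡⟨ cong (∣_- (k + m) % n ∣) wrapped ⟩
  ∣ (k + m) % n + (n ∸ k) - (k + m) % n ∣  ≡⟨ ∣-∣-comm _ ((k + m) % n) ⟩
  ∣ (k + m) % n - (k + m) % n + (n ∸ k) ∣  ≡⟨ ∣m-m+n∣≡n ((k + m) % n) (n ∸ k) ⟩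
  n ∸ k                                    ∎)
  where
  n≤m%n+k : n ≤ m % n + k
  n≤m%n+k = ≮⇒≥ wrap
  wraps : (k + m) % n ≡ m % n + k ∸ n
  wraps = begin
    (k + m) % n            ≡⟨ [k+m]%n≡[m%n+k]%n m k n ⟩
    (m % n + k) % n        ≡⟨ m≤n⇒[n∸m]%m≡n%m n≤m%n+k ⟨
    (m % n + k ∸ n) % n    ≡⟨ m<n⇒m%n≡m (m<n+o⇒m∸n<o (m % n + k) n (+-mono-< (m%n<n m n) k<n)) ⟩
    m % n + k ∸ n          ∎
  wrapped : m % n ≡ (k + m) % n + (n ∸ k)
  wrapped = +-cancelʳ-≡ k _ _ (begin
    m % n + k                  ≡⟨ m∸n+n≡m n≤m%n+k ⟨
    m % n + k ∸ n + n          ≡⟨ cong (_+ n) wraps ⟨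
    (k + m) % n + n            ≡⟨ cong ((k + m) % n +_) (m∸n+n≡m (<⇒≤ k<n)) ⟨
    (k + m) % n + (n ∸ k + k)  ≡⟨ +-assoc ((k + m) % n) (n ∸ k) k ⟨
    (k + m) % n + (n ∸ k) + k  ∎)

-- `extensible d prev` decides whether the labels `prev`, listed most recent first, can be followed by
-- d further labels below `width` such that labels t positions apart differ by at least `separation t`.
module Windows (separation : ℕ → ℕ) (width : ℕ) where

  compatibleFrom : ℕ → ℕ → List ℕ → Bool
  compatibleFrom t c []       = true
  compatibleFrom t c (x ∷ xs) = (separation t ≤ᵇ ∣ c - x ∣) ∧ compatibleFrom (suc t) c xs

  -- Opaque, so that the type checker never runs the search merely to compare types that mention it.
  opaque
    extensible : ℕ → List ℕ → Bool
    extensible zero    prev = true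
    extensible (suc d) prev = any (λ c → compatibleFrom 1 c prev ∧ extensible d (c ∷ prev)) (downFrom width)

  Separated : (ℕ → ℕ) → Set
  Separated h = ∀ i t → separation t ≤ ∣ h (t + i) - h i ∣

  compatible-prefix : ∀ {h} → Separated h → ∀ t m → T (compatibleFrom (suc t) (h (t + m)) (applyDownFrom h m))
  compatible-prefix separated t zero    = _
  compatible-prefix separated t (suc m) rewrite +-suc t m =
    Equivalence.from T-∧ (≤⇒≤ᵇ (separated m (suc t)) , compatible-prefix separated (suc t) m)

  opaque
    unfolding extensible

    extensible-prefix : ∀ {h} → (∀ i → h i < width) → Separated h → ∀ d m → T (extensible d (applyDownFrom h m))
    extensible-prefix h<width separated zero    m = _
    extensible-prefix h<width separated (suc d) m = any⁺ _ (lose (∈-downFrom⁺ (h<width m))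
      (Equivalence.from T-∧ (compatible-prefix separated 0 m , extensible-prefix h<width separated d (suc m))))

  separated⇒extensible : ∀ {h} → (∀ i → h i < width) → Separated h → ∀ d → T (extensible d [])
  separated⇒extensible h<width separated d = extensible-prefix h<width separated d 0

-- For 0 < t: 4 ∸ (distance from 0 to t in the Cayley graph of ℤ with generators ±1, ±4), and 0 when that
-- distance exceeds 3.
separation : ℕ → ℕ
separation 1  = 3
separation 2  = 2
separation 3  = 2
separation 4  = 3
separation 5  = 2
separation 6  = 1
separation 7  = 1
separation 8  = 2
separation 9  = 1
separation 12 = 1
separation _  = 0

open Windows separation 15

opaque
  unfolding extensible

  no-window-of-length-22 : ¬ T (extensible 22 [])
  no-window-of-length-22 ()

data Hop : ℕ → ℕ → Set where
  up₁   : ∀ {i} → Hop i (1 + i)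
  up₄   : ∀ {i} → Hop i (4 + i)
  down₁ : ∀ {i} → Hop (1 + i) i
  down₄ : ∀ {i} → Hop (4 + i) i

_⊕_ : ℕ × ℕ → ℕ × ℕ → ℕ × ℕ
(p , m) ⊕ (p′ , m′) = p + p′ , m + m′

steps : List (ℕ × ℕ)
steps = (1 , 0) ∷ (4 , 0) ∷ (0 , 1) ∷ (0 , 4) ∷ []

swap-∈-steps : ∀ {s} → s ∈ steps → swap s ∈ steps
swap-∈-steps (here refl)                         = there (there (here refl))
swap-∈-steps (there (here refl))                 = there (there (there (here refl)))
swap-∈-steps (there (there (here refl)))         = here refl
swap-∈-steps (there (there (there (here refl)))) = there (here refl)

displacements : ℕ → List (ℕ × ℕ)
displacements zero    = (0 , 0) ∷ []
displacements (suc d) = cartesianProductWith _⊕_ steps (displacements d)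

label : Fin 16 → ℕ
label = lookup (0 ∷ 5 ∷ 10 ∷ 15 ∷ 3 ∷ 8 ∷ 13 ∷ 1 ∷ 6 ∷ 11 ∷ 4 ∷ 9 ∷ 14 ∷ 2 ∷ 7 ∷ 12 ∷ [])

Separates : ℕ → ℕ × ℕ → Set
Separates d (p , m) = ∀ r r′ → (toℕ r′ + m) % 16 ≡ (toℕ r + p) % 16 → p ≢ m → 3 < ∣ label r - label r′ ∣ + d

separates? : ∀ d → Decidable (Separates d)
separates? d (p , m) = all? λ r → all? λ r′ →
  ((toℕ r′ + m) % 16 ≟ (toℕ r + p) % 16) →-dec (¬? (p ≟ m) →-dec (3 <? ∣ label r - label r′ ∣ + d))

separates-by-evaluation : ∀ d → From-yes (All.all? (separates? d) (displacements d))
separates-by-evaluation d = from-yes (All.all? (separates? d) (displacements d))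

separates-within-3 : ∀ {d} → d ≤ 3 → All (Separates d) (displacements d)
separates-within-3 z≤n                   = separates-by-evaluation 0
separates-within-3 (s≤s z≤n)             = separates-by-evaluation 1
separates-within-3 (s≤s (s≤s z≤n))       = separates-by-evaluation 2
separates-within-3 (s≤s (s≤s (s≤s z≤n))) = separates-by-evaluation 3

module Circulant (N : ℕ) (12<N : 12 < N) where

  instance
    N-nonZero : NonZero N
    N-nonZero = >-nonZero (≤-<-trans z≤n 12<N)

  S : List ℕ
  S = 1 ∷ 4 ∷ (N ∸ 4) ∷ (N ∸ 1) ∷ []

  Adj : Fin N → Fin N → Set
  Adj = CircAdj N S

  vertex : ℕ → Fin N
  vertex a = a mod N

  toℕ-vertex : ∀ a → toℕ (vertex a) ≡ a % N
  toℕ-vertex a = toℕ-fromℕ< (m%n<n a N)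

  small<N : ∀ t {t≤12 : True (t ≤? 12)} → t < N
  small<N t {t≤12} = ≤-<-trans (toWitness t≤12) 12<N

  vertex≢vertex-+ : ∀ a {t} → 0 < t → t < N → vertex a ≢ vertex (t + a)
  vertex≢vertex-+ a {t} 0<t t<N eq = <⇒≢ 0<t (sym (begin
    t          ≡⟨ m<n⇒m%n≡m t<N ⟨
    t % N      ≡⟨ %-cancel-+ʳ t 0 a N (sym (trans (sym (toℕ-vertex a)) (trans (cong toℕ eq) (toℕ-vertex (t + a))))) ⟩
    0 % N      ≡⟨ m<n⇒m%n≡m (small<N 0) ⟩
    0          ∎))

  vertex-adjacent : ∀ {t} → t ∈ 1 ∷ 4 ∷ [] → ∀ a → Adj (vertex a) (vertex (t + a))
  vertex-adjacent {t} t∈ a = vertex≢vertex-+ a (0<t t∈) (t<N t∈) ,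
    subst₂ (λ X Y → ∣ X - Y ∣ ∈ S) (sym (toℕ-vertex a)) (sym (toℕ-vertex (t + a)))
      ([ (λ eq → subst (_∈ S) (sym eq) (t∈S t∈)) , (λ eq → subst (_∈ S) (sym eq) (N∸t∈S t∈)) ]
        (∣m%n-[k+m]%n∣≡k⊎n∸k a t N (t<N t∈)))
    where
    0<t : ∀ {t} → t ∈ 1 ∷ 4 ∷ [] → 0 < t
    0<t (here refl)         = s≤s z≤n
    0<t (there (here refl)) = s≤s z≤n
    t<N : ∀ {t} → t ∈ 1 ∷ 4 ∷ [] → t < N
    t<N (here refl)         = small<N 1
    t<N (there (here refl)) = small<N 4
    t∈S : ∀ {t} → t ∈ 1 ∷ 4 ∷ [] → t ∈ S
    t∈S (here refl)         = here refl
    t∈S (there (here refl)) = there (here refl)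
    N∸t∈S : ∀ {t} → t ∈ 1 ∷ 4 ∷ [] → N ∸ t ∈ S
    N∸t∈S (here refl)         = there (there (there (here refl)))
    N∸t∈S (there (here refl)) = there (there (here refl))

  hop⇒adjacent : ∀ x {i j} → Hop i j → Adj (vertex (i + x)) (vertex (j + x))
  hop⇒adjacent x up₁   = vertex-adjacent (here refl) _
  hop⇒adjacent x up₄   = vertex-adjacent (there (here refl)) _
  hop⇒adjacent x down₁ = circAdj-sym (vertex-adjacent (here refl) _)
  hop⇒adjacent x down₄ = circAdj-sym (vertex-adjacent (there (here refl)) _)

  span≥15 : ∀ {f s} → IsL321 Adj f → HasSpan f s → 15 ≤ s
  span≥15 {f} {s} isL321 (lo , bounds , _) = ≮⇒≥ λ s<15 →
    no-window-of-length-22 (separated⇒extensible {h} (h<15 s<15) separated 22)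
    where
    h : ℕ → ℕ
    h i = f (vertex i) ∸ lo

    h<15 : s < 15 → ∀ i → h i < 15
    h<15 s<15 i = ≤-<-trans (m≤n+o⇒m∸n≤o (f (vertex i)) lo (proj₂ (bounds (vertex i)))) s<15

    gap : ∀ a b → ∣ f (vertex a) - f (vertex b) ∣ ≡ ∣ h b - h a ∣
    gap a b = begin
      ∣ f (vertex a) - f (vertex b) ∣  ≡⟨ cong₂ ∣_-_∣ (lift a) (lift b) ⟩
      ∣ lo + h a - lo + h b ∣          ≡⟨ ∣m+n-m+o∣≡∣n-o∣ lo (h a) (h b) ⟩
      ∣ h a - h b ∣                    ≡⟨ ∣-∣-comm (h a) (h b) ⟩
      ∣ h b - h a ∣                    ∎
      where
      lift : ∀ a → f (vertex a) ≡ lo + h a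
      lift a = sym (m+[n∸m]≡n (proj₁ (bounds (vertex a))))

    apart : ∀ i {t d} .{{_ : NonZero t}} {t≤12 : True (t ≤? 12)} → Walk Hop 0 t d → 4 ∸ d ≤ ∣ h (t + i) - h i ∣
    apart i {t} {d} {t≤12} w =
      m≤n+o⇒m∸n≤o 4 d (subst (4 ≤_) (trans (+-comm _ d) (cong (d +_) (gap i (t + i)))) far-apart)
      where
      far-apart : 3 < ∣ f (vertex i) - f (vertex (t + i)) ∣ + d
      far-apart = isL321⇒walkSeparated {Adj = Adj} {f} isL321
        (vertex≢vertex-+ i (>-nonZero⁻¹ t) (small<N t {t≤12}))
        (walk-gmap (λ j → vertex (j + i)) (hop⇒adjacent i) w)

    separated : Separated h
    separated i 0  = z≤n
    separated i 1  = apart i (cons up₁ nil)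
    separated i 2  = apart i (cons up₁ (cons up₁ nil))
    separated i 3  = apart i (cons up₄ (cons down₁ nil))
    separated i 4  = apart i (cons up₄ nil)
    separated i 5  = apart i (cons up₄ (cons up₁ nil))
    separated i 6  = apart i (cons up₄ (cons up₁ (cons up₁ nil)))
    separated i 7  = apart i (cons up₄ (cons up₄ (cons down₁ nil)))
    separated i 8  = apart i (cons up₄ (cons up₄ nil))
    separated i 9  = apart i (cons up₄ (cons up₄ (cons up₁ nil)))
    separated i 10 = z≤n
    separated i 11 = z≤n
    separated i 12 = apart i (cons up₄ (cons up₄ (cons up₄ nil)))
    separated i (suc (suc (suc (suc (suc (suc (suc (suc (suc (suc (suc (suc (suc _))))))))))))) = z≤n

  -- (p , m) stands for the net displacement p − m: the index moves from X to Y ≡ X + p − m (mod N).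
  Moves : ℕ → ℕ → ℕ × ℕ → Set
  Moves X Y (p , m) = (Y + m) % N ≡ (X + p) % N

  moves-ahead : ∀ {X Y} c → X + c ≡ Y → Moves X Y (c , 0)
  moves-ahead {X} {Y} c eq = cong (_% N) (trans (+-identityʳ Y) (sym eq))

  moves-around : ∀ {X Y} t → t < N → X + (N ∸ t) ≡ Y → Moves X Y (0 , t)
  moves-around {X} {Y} t t<N eq = begin
    (Y + t) % N            ≡⟨ cong (λ Z → (Z + t) % N) eq ⟨
    (X + (N ∸ t) + t) % N  ≡⟨ cong (_% N) (trans (+-assoc X (N ∸ t) t) (cong (X +_) (m∸n+n≡m (<⇒≤ t<N)))) ⟩
    (X + N) % N            ≡⟨ [m+n]%n≡m%n X N ⟩
    X % N                  ≡⟨ cong (_% N) (+-identityʳ X) ⟨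
    (X + 0) % N            ∎

  moves-forward : ∀ {X Y c} → c ∈ S → X + c ≡ Y → ∃[ s ] s ∈ steps × Moves X Y s
  moves-forward (here refl)                         eq = (1 , 0) , here refl , moves-ahead 1 eq
  moves-forward (there (here refl))                 eq = (4 , 0) , there (here refl) , moves-ahead 4 eq
  moves-forward (there (there (here refl))) eq =
    (0 , 4) , there (there (there (here refl))) , moves-around 4 (small<N 4) eq
  moves-forward (there (there (there (here refl)))) eq =
    (0 , 1) , there (there (here refl)) , moves-around 1 (small<N 1) eq

  edge-moves : ∀ {x y} → Adj x y → ∃[ s ] s ∈ steps × Moves (toℕ x) (toℕ y) s
  edge-moves {x} {y} (_ , x-y∈S) with m+∣m-n∣≡n⊎n+∣m-n∣≡m (toℕ x) (toℕ y)
  ... | inj₁ eq = moves-forward x-y∈S eq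
  ... | inj₂ eq = let s , s∈steps , moves = moves-forward x-y∈S eq
                  in swap s , swap-∈-steps s∈steps , sym moves

  moves-trans : ∀ {X Y Z} s o → Moves X Y s → Moves Y Z o → Moves X Z (s ⊕ o)
  moves-trans {X} {Y} {Z} (p , m) (p′ , m′) XY YZ = begin
    (Z + (m + m′)) % N  ≡⟨ cong (_% N) (x∙yz≈xz∙y Z m m′) ⟩
    (Z + m′ + m) % N    ≡⟨ %-cong-+ʳ (Z + m′) (Y + p′) m N YZ ⟩
    (Y + p′ + m) % N    ≡⟨ cong (_% N) (xy∙z≈xz∙y Y p′ m) ⟩
    (Y + m + p′) % N    ≡⟨ %-cong-+ʳ (Y + m) (X + p) p′ N XY ⟩
    (X + p + p′) % N    ≡⟨ cong (_% N) (+-assoc X p p′) ⟩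
    (X + (p + p′)) % N  ∎

  walk-moves : ∀ {x y d} → Walk Adj x y d → ∃[ o ] o ∈ displacements d × Moves (toℕ x) (toℕ y) o
  walk-moves nil = (0 , 0) , here refl , refl
  walk-moves (cons e w) =
    let s , s∈steps , moves₁ = edge-moves e
        o , o∈displacements , moves₂ = walk-moves w
    in s ⊕ o , ∈-cartesianProductWith⁺ _⊕_ s∈steps o∈displacements , moves-trans s o moves₁ moves₂

  moves-distinct : ∀ {X Y p m} → X < N → Y < N → X ≢ Y → Moves X Y (p , m) → p ≢ m
  moves-distinct {X} {Y} {p} X<N Y<N X≢Y moves refl = X≢Y (begin
    X      ≡⟨ m<n⇒m%n≡m X<N ⟨
    X % N  ≡⟨ %-cancel-+ʳ X Y p N (sym moves) ⟩
    Y % N  ≡⟨ m<n⇒m%n≡m Y<N ⟩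
    Y      ∎)

  module _ (16∣N : 16 ∣ N) where

    moves-residue : ∀ {X Y p m} → Moves X Y (p , m) → (Y % 16 + m) % 16 ≡ (X % 16 + p) % 16
    moves-residue {X} {Y} {p} {m} moves = begin
      (Y % 16 + m) % 16  ≡⟨ %-cong-+ʳ (Y % 16) Y m 16 (m%n%n≡m%n Y 16) ⟩
      (Y + m) % 16       ≡⟨ m∣n⇒o%n%m≡o%m 16 N (Y + m) 16∣N ⟨
      (Y + m) % N % 16   ≡⟨ cong (_% 16) moves ⟩
      (X + p) % N % 16   ≡⟨ m∣n⇒o%n%m≡o%m 16 N (X + p) 16∣N ⟩
      (X + p) % 16       ≡⟨ %-cong-+ʳ (X % 16) X p 16 (m%n%n≡m%n X 16) ⟨
      (X % 16 + p) % 16  ∎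

    residueLabelling : Fin N → ℕ
    residueLabelling x = label (toℕ x mod 16)

    residueLabelling-separated : WalkSeparated Adj residueLabelling
    residueLabelling-separated {x} {y} {d} x≢y w with d ≤? 3
    ... | no d≰3 = ≤-trans (≰⇒> d≰3) (m≤n+m d _)
    ... | yes d≤3 =
      let (p , m) , o∈displacements , moves = walk-moves w in
      All.lookup (separates-within-3 d≤3) o∈displacements (toℕ x mod 16) (toℕ y mod 16)
        (subst₂ (λ r r′ → (r′ + m) % 16 ≡ (r + p) % 16) (sym (toℕ-mod x)) (sym (toℕ-mod y))
          (moves-residue {toℕ x} {toℕ y} moves))
        (moves-distinct (toℕ<n x) (toℕ<n y) (λ eq → x≢y (toℕ-injective eq)) moves)
      where
      toℕ-mod : ∀ x → toℕ (toℕ x mod 16) ≡ toℕ x % 16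
      toℕ-mod x = toℕ-fromℕ< (m%n<n (toℕ x) 16)

    residueLabelling-span : HasSpan residueLabelling 15
    residueLabelling-span =
      0 , (λ x → z≤n , label≤15 (toℕ x mod 16)) , (vertex 0 , at 0 (small<N 0)) , (vertex 3 , at 3 (small<N 3))
      where
      label≤15 : ∀ r → label r ≤ 15
      label≤15 = from-yes (all? λ r → label r ≤? 15)
      at : ∀ a → a < N → residueLabelling (vertex a) ≡ label (a mod 16)
      at a a<N = cong (λ b → label (b mod 16)) (trans (toℕ-vertex a) (m<n⇒m%n≡m a<N))

    λ₃₂₁≡15 : Lambda321≡ Adj 15
    λ₃₂₁≡15 =
      (residueLabelling , walkSeparated⇒isL321 {f = residueLabelling} residueLabelling-separated , residueLabelling-span) ,
      λ f s isL321 span → span≥15 isL321 span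

mainTheorem8 : (k n : ℕ) → 1 ≤ k → n ≡ 16 * k →
    Lambda321≡ (CircAdj n (1 ∷ 4 ∷ (n ∸ 4) ∷ (n ∸ 1) ∷ [])) 15
mainTheorem8 k .(16 * k) 1≤k refl =
  Circulant.λ₃₂₁≡15 (16 * k) (≤-trans (≤ᵇ⇒≤ 13 16 _) (*-monoʳ-≤ 16 1≤k)) (m∣m*n k)
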